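{- For integers $h\ge 0$ and $m\ge 1$, $\chi_{la}(Sp(3,\,2m+1,\,2m+2h+1))=4$.
   Context: All graphs are finite, simple and connected. For a graph $G=(V,E)$ with $q=|E|$ edges, a local antimagic labeling of $G$ is a bijection $f:E\to\{1,\dots,q\}$ such that $f^+(x)\ne f^+(y)$ for every pair of adjacent vertices $x,y$, where $f^+(x)=\sum_{e\ni x} f(e)$. The local antimagic chromatic number $\chi_{la}(G)$ is the minimum, over all local antimagic labelings $f$ of $G$, of the number of distinct values taken by $f^+$. For integers $y_1,y_2,y_3\ge 1$, the spider $Sp(y_1,y_2,y_3)$ is the tree obtained from three paths of lengths (numbers of edges) $y_1,y_2,y_3$ by identifying one end-vertex of each path into a single vertex (the core). -}

module Defs where

open import Data.Nat using (ℕ; zero; suc; _+_; _*_; _≤_; _≟_)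
open import Data.Bool using (if_then_else_; _∨_)
open import Data.Nat using (_≡ᵇ_)
open import Data.List using (List; []; _∷_; map; upTo; _++_; length; zipWith; deduplicate)
open import Data.Nat.ListAction using (sum)
open import Data.List.Relation.Binary.Permutation.Propositional using (_↭_)
open import Data.List.Relation.Unary.All using (All)
open import Data.Product using (_×_; _,_; Σ; ∃)
open import Relation.Binary.PropositionalEquality using (_≢_; _≡_)

-- A finite simple graph on vertex set {0,…,order-1} with an explicit list of
-- edges (each edge an unordered pair given as (u , v)); the edges are indexed
-- by their position in the list.
record Graph : Set where
  constructor mkGraph
  field
    order : ℕ
    edges : List (ℕ × ℕ)

open Graph public

-- A labeling of the edges: the i-th entry is the label of the i-th edge.
Labeling : Set
Labeling = List ℕ

contrib : ℕ → (ℕ × ℕ) → ℕ → ℕ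
contrib x (u , v) l = if (x ≡ᵇ u) ∨ (x ≡ᵇ v) then l else 0

vsum : Graph → Labeling → ℕ → ℕ
vsum G f x = sum (zipWith (contrib x) (edges G) f)

oneTo : ℕ → List ℕ
oneTo q = map suc (upTo q)

-- f is a bijection E → {1,…,q}: the label list is a permutation of [1..q]
IsBijLabeling : Graph → Labeling → Set
IsBijLabeling G f = f ↭ oneTo (length (edges G))

IsLocalAntimagic : Graph → Labeling → Set
IsLocalAntimagic G f =
  IsBijLabeling G f ×
  All (λ e → vsum G f (Data.Product.proj₁ e) ≢ vsum G f (Data.Product.proj₂ e)) (edges G)

numColors : Graph → Labeling → ℕ
numColors G f = length (deduplicate _≟_ (map (vsum G f) (upTo (order G))))

ChiLaEq : Graph → ℕ → Set
ChiLaEq G k =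
  (Σ Labeling λ f → IsLocalAntimagic G f × numColors G f ≡ k)
  × (∀ f → IsLocalAntimagic G f → k ≤ numColors G f)

-- start vertex of the j-th edge of a leg whose non-core vertices are o+1,…,o+y
legStart : ℕ → ℕ → ℕ
legStart o zero = 0
legStart o (suc k) = o + suc k

legEdges : ℕ → ℕ → List (ℕ × ℕ)
legEdges o y = map (λ j → legStart o j , o + suc j) (upTo y)

-- Spider Sp(y1,y2,y3): core vertex 0, leg i has vertices numbered consecutively.
spider : ℕ → ℕ → ℕ → Graph
spider y1 y2 y3 =
  mkGraph (suc (y1 + y2 + y3))
          (legEdges 0 y1 ++ legEdges y1 y2 ++ legEdges (y1 + y2) y3)

-- Lower bound: the pendant vertices of the three legs have sums ℓ₁, ℓ₂, ℓ₃, the (distinct) labels of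
-- the pendant edges, and the neighbour of the pendant vertex with the largest ℓᵢ has sum uᵢ + ℓᵢ
-- (uᵢ ≥ 1 the label of the preceding edge), larger than every ℓⱼ; so any spider whose legs all have length ≥ 2 needs four distinct sums.
-- Upper bound: on a leg labelled by a zigzag the sums of consecutive labels alternate between s and
-- s + 1, so three zigzags with common s = Q = q - 2 ending in Q, Q + 1, Q + 2 leave only the vertex
-- sums Q, Q + 1, Q + 2 and the core sum X, and neighbouring vertices never share a sum.
module Submission where

open import Defs
open import Data.Nat using (ℕ; zero; suc; _+_; _*_; _≤_; _<_; _≟_; _≤?_; _≡ᵇ_; z≤n; s≤s)
open import Data.Nat.Properties
open import Data.Bool using (true; false; T)
open import Data.Unit using (tt)
open import Data.Empty using (⊥-elim)
open import Data.List using (List; []; _∷_; [_]; map; upTo; applyUpTo; _++_; length; zipWith; deduplicate)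
open import Data.List.Properties using (map-cong; map-cong-local; map-++; map-id; map-applyUpTo; ++-assoc; length-++; length-++-sucʳ; length-map; length-applyUpTo)
open import Data.Nat.ListAction using (sum)
open import Data.Nat.ListAction.Properties using (sum-++)
open import Data.Nat.Tactic.RingSolver using (solve-∀)
import Algebra.Solver.CommutativeMonoid
open import Data.List.Relation.Unary.All using (All; []; _∷_)
import Data.List.Relation.Unary.All as All
import Data.List.Relation.Unary.All.Properties as AllP
open import Data.List.Relation.Unary.Any using (here; there)
import Data.List.Relation.Unary.Any.Properties as AnyP
open import Data.List.Relation.Unary.AllPairs using ([]; _∷_)
open import Data.List.Relation.Unary.Unique.Propositional using (Unique)
open import Data.List.Relation.Unary.Unique.DecPropositional.Properties using (deduplicate-!)
import Data.List.Relation.Unary.Unique.Propositional.Properties as UP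
open import Data.List.Relation.Unary.Linked using (Linked; []; [-]; _∷_)
import Data.List.Relation.Unary.Linked as Linked
open import Data.List.Membership.Propositional using (_∈_)
open import Data.List.Membership.Propositional.Properties using (∈-++⁺ˡ; ∈-++⁺ʳ; ∈-∃++)
open import Data.List.Relation.Binary.Permutation.Propositional
  using (_↭_; ↭-refl; ↭-sym; prep; ↭⇒↭ₛ; module PermutationReasoning)
open import Data.List.Relation.Binary.Permutation.Propositional.Properties
  using (All-resp-↭; ↭-length; shift; ++⁺ˡ; ++⁺; ++-commutativeMonoid)
open import Relation.Nullary using (yes; no)
open import Data.Product using (_×_; _,_; Σ; proj₁; proj₂)
open import Function using (_∘_; id)
open import Relation.Binary.PropositionalEquality hiding ([_])
open import Data.List.Relation.Binary.Permutation.Setoid.Properties (setoid ℕ) using (Unique-resp-↭)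

consecutive : ℕ → ℕ → List ℕ
consecutive s zero = []
consecutive s (suc n) = s ∷ consecutive (suc s) n

pathEdges : ℕ → ℕ → List (ℕ × ℕ)
pathEdges s zero = []
pathEdges s (suc n) = (s , suc s) ∷ pathEdges (suc s) n

applyUpTo-consecutive : ∀ {A : Set} n s (g : ℕ → A) (f : ℕ → A) → (∀ j → g j ≡ f (s + j)) →
                        applyUpTo g n ≡ map f (consecutive s n)
applyUpTo-consecutive zero s g f g≗f = refl
applyUpTo-consecutive (suc n) s g f g≗f =
  cong₂ _∷_ (trans (g≗f 0) (cong f (+-identityʳ s)))
            (applyUpTo-consecutive n (suc s) (g ∘ suc) f (λ j → trans (g≗f (suc j)) (cong f (+-suc s j))))

applyUpTo-pathEdges : ∀ n s (g : ℕ → ℕ × ℕ) → (∀ j → g j ≡ (s + j , suc (s + j))) →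
                      applyUpTo g n ≡ pathEdges s n
applyUpTo-pathEdges zero s g g≗e = refl
applyUpTo-pathEdges (suc n) s g g≗e =
  cong₂ _∷_ (trans (g≗e 0) (cong (λ v → v , suc v) (+-identityʳ s)))
            (applyUpTo-pathEdges n (suc s) (g ∘ suc)
              (λ j → trans (g≗e (suc j)) (cong (λ v → v , suc v) (+-suc s j))))

upTo-consecutive : ∀ n → upTo n ≡ consecutive 0 n
upTo-consecutive n = trans (applyUpTo-consecutive n 0 id id (λ _ → refl)) (map-id (consecutive 0 n))

map-suc-consecutive : ∀ s n → map suc (consecutive s n) ≡ consecutive (suc s) n
map-suc-consecutive s zero = refl
map-suc-consecutive s (suc n) = cong (suc s ∷_) (map-suc-consecutive (suc s) n)

oneTo-consecutive : ∀ q → oneTo q ≡ consecutive 1 q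
oneTo-consecutive q = trans (cong (map suc) (upTo-consecutive q)) (map-suc-consecutive 0 q)

consecutive-++ : ∀ s a b t → s + a ≡ t → consecutive s (a + b) ≡ consecutive s a ++ consecutive t b
consecutive-++ s zero b t s+0≡t rewrite +-identityʳ s | s+0≡t = refl
consecutive-++ s (suc a) b t eq = cong (s ∷_) (consecutive-++ (suc s) a b t (trans (sym (+-suc s a)) eq))

consecutive-∷ʳ : ∀ s k → consecutive s (suc k) ≡ consecutive s k ++ [ s + k ]
consecutive-∷ʳ s zero = cong [_] (sym (+-identityʳ s))
consecutive-∷ʳ s (suc k) =
  cong (s ∷_) (trans (consecutive-∷ʳ (suc s) k) (cong (λ t → consecutive (suc s) k ++ [ t ]) (sym (+-suc s k))))

legEdges-suc : ∀ o y → legEdges o (suc y) ≡ (0 , suc o) ∷ pathEdges (suc o) y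
legEdges-suc o y = cong₂ _∷_ (cong (0 ,_) (+-comm o 1))
  (trans (map-applyUpTo suc (λ j → legStart o j , o + suc j) y)
         (applyUpTo-pathEdges y (suc o) _
           (λ j → cong₂ _,_ (+-suc o j) (trans (+-suc o (suc j)) (cong suc (+-suc o j))))))

length-legEdges : ∀ o y → length (legEdges o y) ≡ y
length-legEdges o y = trans (length-map _ (upTo y)) (length-applyUpTo id y)

≡ᵇ-refl : ∀ n → (n ≡ᵇ n) ≡ true
≡ᵇ-refl zero = refl
≡ᵇ-refl (suc n) = ≡ᵇ-refl n

contrib-outside : ∀ x u v l → x ≢ u → x ≢ v → contrib x (u , v) l ≡ 0
contrib-outside x u v l x≢u x≢v with x ≡ᵇ u in x≡ᵇu
... | true = ⊥-elim (x≢u (≡ᵇ⇒≡ x u (subst T (sym x≡ᵇu) tt)))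
... | false with x ≡ᵇ v in x≡ᵇv
...   | true = ⊥-elim (x≢v (≡ᵇ⇒≡ x v (subst T (sym x≡ᵇv) tt)))
...   | false = refl

contrib-left : ∀ x v l → contrib x (x , v) l ≡ l
contrib-left x v l rewrite ≡ᵇ-refl x = refl

contrib-right : ∀ x u l → contrib x (u , x) l ≡ l
contrib-right x u l with x ≡ᵇ u
... | true = refl
... | false rewrite ≡ᵇ-refl x = refl

legVertexSums : List ℕ → List ℕ
legVertexSums [] = []
legVertexSums (a ∷ []) = a ∷ []
legVertexSums (a ∷ b ∷ r) = (a + b) ∷ legVertexSums (b ∷ r)

pathSum : ℕ → List ℕ → ℕ → ℕ
pathSum s L x = sum (zipWith (contrib x) (pathEdges s (length L)) L)

pathSum-before : ∀ s L x → x < s → pathSum s L x ≡ 0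
pathSum-before s [] x x<s = refl
pathSum-before s (l ∷ L) x x<s =
  cong₂ _+_ (contrib-outside x s (suc s) l (<⇒≢ x<s) (<⇒≢ (m<n⇒m<1+n x<s)))
            (pathSum-before (suc s) L x (m<n⇒m<1+n x<s))

pathSum-after : ∀ s L x → s + length L < x → pathSum s L x ≡ 0
pathSum-after s [] x _ = refl
pathSum-after s (l ∷ L) x s+1+n<x =
  cong₂ _+_ (contrib-outside x s (suc s) l (>⇒≢ (m+n≤o⇒m≤o (suc s) s+1+n<x))
                                           (>⇒≢ (m+n≤o⇒m≤o (suc (suc s)) 1+s+n<x)))
            (pathSum-after (suc s) L x 1+s+n<x)
  where
  1+s+n<x : suc s + length L < x
  1+s+n<x = subst (_< x) (+-suc s (length L)) s+1+n<x

All-consecutive : ∀ {P : ℕ → Set} s n → (∀ x → s ≤ x → x < s + n → P x) → All P (consecutive s n)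
All-consecutive s zero _ = []
All-consecutive s (suc n) P-between =
  P-between s ≤-refl (subst (s <_) (sym (+-suc s n)) (s≤s (m≤m+n s n)))
  ∷ All-consecutive (suc s) n
      (λ x s<x x<1+s+n → P-between x (<⇒≤ s<x) (subst (x <_) (sym (+-suc s n)) x<1+s+n))

pathSums-consecutive : ∀ L u s l → u < s →
  map (λ x → contrib x (u , s) l + pathSum s L x) (consecutive s (suc (length L))) ≡ legVertexSums (l ∷ L)
pathSums-consecutive [] u s l u<s = cong [_] (trans (+-identityʳ _) (contrib-right s u l))
pathSums-consecutive (l′ ∷ L) u s l u<s = cong₂ _∷_ atS beyondS
  where
  atS : contrib s (u , s) l + (contrib s (s , suc s) l′ + pathSum (suc s) L s) ≡ l + l′
  atS rewrite contrib-right s u l | contrib-left s (suc s) l′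
            | pathSum-before (suc s) L s ≤-refl | +-identityʳ l′ = refl
  beyondS : map (λ x → contrib x (u , s) l + pathSum s (l′ ∷ L) x) (consecutive (suc s) (suc (length L)))
            ≡ legVertexSums (l′ ∷ L)
  beyondS = trans
    (map-cong-local (All-consecutive (suc s) (suc (length L))
      (λ x s<x _ → cong (_+ pathSum s (l′ ∷ L) x)
         (contrib-outside x u s l (>⇒≢ (<-trans u<s s<x)) (>⇒≢ s<x)))))
    (pathSums-consecutive L s (suc s) l′ ≤-refl)

legSum : ℕ → ℕ → List ℕ → ℕ → ℕ
legSum o y L x = sum (zipWith (contrib x) (legEdges o y) L)

legSum-∷ : ∀ o l L x → legSum o (suc (length L)) (l ∷ L) x ≡ contrib x (0 , suc o) l + pathSum (suc o) L x
legSum-∷ o l L x = cong (λ E → sum (zipWith (contrib x) E (l ∷ L))) (legEdges-suc o (length L))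

legSum-core : ∀ o l L → legSum o (suc (length L)) (l ∷ L) 0 ≡ l
legSum-core o l L = trans (legSum-∷ o l L 0)
  (trans (cong (l +_) (pathSum-before (suc o) L 0 (s≤s z≤n))) (+-identityʳ l))

legSum-before : ∀ o l L x → x ≢ 0 → x ≤ o → legSum o (suc (length L)) (l ∷ L) x ≡ 0
legSum-before o l L x x≢0 x≤o = trans (legSum-∷ o l L x)
  (cong₂ _+_ (contrib-outside x 0 (suc o) l x≢0 (<⇒≢ (s≤s x≤o))) (pathSum-before (suc o) L x (s≤s x≤o)))

legSum-after : ∀ o l L x → o + suc (length L) < x → legSum o (suc (length L)) (l ∷ L) x ≡ 0
legSum-after o l L x o+y<x = trans (legSum-∷ o l L x)
  (cong₂ _+_ (contrib-outside x 0 (suc o) l (>⇒≢ (≤-trans (s≤s z≤n) o+y<x))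
                                            (>⇒≢ (m+n≤o⇒m≤o (suc (suc o)) 1+o+n<x)))
             (pathSum-after (suc o) L x 1+o+n<x))
  where
  1+o+n<x : suc o + length L < x
  1+o+n<x = subst (_< x) (+-suc o (length L)) o+y<x

legSums-leg : ∀ o l L → map (legSum o (suc (length L)) (l ∷ L)) (consecutive (suc o) (suc (length L)))
                        ≡ legVertexSums (l ∷ L)
legSums-leg o l L = trans (map-cong (legSum-∷ o l L) (consecutive (suc o) (suc (length L))))
                          (pathSums-consecutive L 0 (suc o) l (s≤s z≤n))

zipWith-++ : ∀ {A B C : Set} (g : A → B → C) as as′ bs bs′ → length as ≡ length bs →
             zipWith g (as ++ as′) (bs ++ bs′) ≡ zipWith g as bs ++ zipWith g as′ bs′
zipWith-++ g [] as′ [] bs′ _ = refl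
zipWith-++ g (a ∷ as) as′ (b ∷ bs) bs′ eq = cong (g a b ∷_) (zipWith-++ g as as′ bs bs′ (suc-injective eq))

vsum-spider : ∀ y1 y2 y3 f1 f2 f3 → length f1 ≡ y1 → length f2 ≡ y2 → ∀ x →
  vsum (spider y1 y2 y3) (f1 ++ f2 ++ f3) x ≡ legSum 0 y1 f1 x + (legSum y1 y2 f2 x + legSum (y1 + y2) y3 f3 x)
vsum-spider y1 y2 y3 f1 f2 f3 ∣f1∣ ∣f2∣ x = begin
  sum (zipWith (contrib x) (E1 ++ E2 ++ E3) (f1 ++ f2 ++ f3))
    ≡⟨ cong sum (zipWith-++ (contrib x) E1 _ f1 _ (trans (length-legEdges 0 y1) (sym ∣f1∣))) ⟩
  sum (zipWith (contrib x) E1 f1 ++ zipWith (contrib x) (E2 ++ E3) (f2 ++ f3))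
    ≡⟨ sum-++ (zipWith (contrib x) E1 f1) _ ⟩
  legSum 0 y1 f1 x + sum (zipWith (contrib x) (E2 ++ E3) (f2 ++ f3))
    ≡⟨ cong (λ s → legSum 0 y1 f1 x + sum s) (zipWith-++ (contrib x) E2 _ f2 _ (trans (length-legEdges y1 y2) (sym ∣f2∣))) ⟩
  legSum 0 y1 f1 x + sum (zipWith (contrib x) E2 f2 ++ zipWith (contrib x) E3 f3)
    ≡⟨ cong (legSum 0 y1 f1 x +_) (sum-++ (zipWith (contrib x) E2 f2) _) ⟩
  legSum 0 y1 f1 x + (legSum y1 y2 f2 x + legSum (y1 + y2) y3 f3 x) ∎
  where
  open ≡-Reasoning
  E1 E2 E3 : List (ℕ × ℕ)
  E1 = legEdges 0 y1
  E2 = legEdges y1 y2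
  E3 = legEdges (y1 + y2) y3

Linked⇒pathEdges-distinct : ∀ n s (g : ℕ → ℕ) → Linked _≢_ (map g (consecutive s (suc n))) →
                            All (λ e → g (proj₁ e) ≢ g (proj₂ e)) (pathEdges s n)
Linked⇒pathEdges-distinct zero s g _ = []
Linked⇒pathEdges-distinct (suc n) s g (gs≢gs+1 ∷ linked) = gs≢gs+1 ∷ Linked⇒pathEdges-distinct n (suc s) g linked

Linked⇒legEdges-distinct : ∀ o n (g : ℕ → ℕ) → Linked _≢_ (g 0 ∷ map g (consecutive (suc o) (suc n))) →
                           All (λ e → g (proj₁ e) ≢ g (proj₂ e)) (legEdges o (suc n))
Linked⇒legEdges-distinct o n g linked = subst (All _) (sym (legEdges-suc o n))
  (Linked.head linked ∷ Linked⇒pathEdges-distinct n (suc o) g (Linked.tail linked))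

module SpiderLabeling (a1 : ℕ) (L1 : List ℕ) (a2 : ℕ) (L2 : List ℕ) (a3 : ℕ) (L3 : List ℕ) where

  y1 y2 y3 : ℕ
  y1 = suc (length L1)
  y2 = suc (length L2)
  y3 = suc (length L3)

  f1 f2 f3 f : List ℕ
  f1 = a1 ∷ L1
  f2 = a2 ∷ L2
  f3 = a3 ∷ L3
  f = f1 ++ f2 ++ f3

  G : Graph
  G = spider y1 y2 y3

  g : ℕ → ℕ
  g = vsum G f

  g-split : ∀ x → g x ≡ legSum 0 y1 f1 x + (legSum y1 y2 f2 x + legSum (y1 + y2) y3 f3 x)
  g-split = vsum-spider y1 y2 y3 f1 f2 f3 refl refl

  g-core : g 0 ≡ a1 + (a2 + a3)
  g-core = trans (g-split 0)
    (cong₂ _+_ (legSum-core 0 a1 L1) (cong₂ _+_ (legSum-core y1 a2 L2) (legSum-core (y1 + y2) a3 L3)))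

  private
    suc≤⇒≢0 : ∀ {x s} → suc s ≤ x → x ≢ 0
    suc≤⇒≢0 1+s≤x = >⇒≢ (≤-trans (s≤s z≤n) 1+s≤x)

  g-leg1 : map g (consecutive 1 y1) ≡ legVertexSums f1
  g-leg1 = trans
    (map-cong-local (All-consecutive 1 y1 (λ x 1≤x x≤y1 → trans (g-split x)
      (trans (cong (legSum 0 y1 f1 x +_)
               (cong₂ _+_ (legSum-before y1 a2 L2 x (suc≤⇒≢0 1≤x) (≤-pred x≤y1))
                          (legSum-before (y1 + y2) a3 L3 x (suc≤⇒≢0 1≤x) (≤-trans (≤-pred x≤y1) (m≤m+n y1 y2)))))
             (+-identityʳ _)))))
    (legSums-leg 0 a1 L1)

  g-leg2 : map g (consecutive (suc y1) y2) ≡ legVertexSums f2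
  g-leg2 = trans
    (map-cong-local (All-consecutive (suc y1) y2 (λ x y1<x x≤y1+y2 → trans (g-split x)
      (cong₂ _+_ (legSum-after 0 a1 L1 x y1<x)
                 (trans (cong (legSum y1 y2 f2 x +_)
                          (legSum-before (y1 + y2) a3 L3 x (suc≤⇒≢0 y1<x) (≤-pred x≤y1+y2)))
                        (+-identityʳ _))))))
    (legSums-leg y1 a2 L2)

  g-leg3 : map g (consecutive (suc (y1 + y2)) y3) ≡ legVertexSums f3
  g-leg3 = trans
    (map-cong-local (All-consecutive (suc (y1 + y2)) y3 (λ x y1+y2<x _ → trans (g-split x)
      (cong₂ _+_ (legSum-after 0 a1 L1 x (≤-trans (s≤s (m≤m+n y1 y2)) y1+y2<x))
                 (cong (_+ legSum (y1 + y2) y3 f3 x) (legSum-after y1 a2 L2 x y1+y2<x))))))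
    (legSums-leg (y1 + y2) a3 L3)

  vertexSums : map g (upTo (order G)) ≡ (a1 + (a2 + a3)) ∷ legVertexSums f1 ++ legVertexSums f2 ++ legVertexSums f3
  vertexSums = begin
    map g (upTo (order G))
      ≡⟨ cong (map g) (upTo-consecutive (order G)) ⟩
    g 0 ∷ map g (consecutive 1 (y1 + y2 + y3))
      ≡⟨ cong₂ _∷_ g-core (cong (map g) (trans (consecutive-++ 1 (y1 + y2) y3 (suc (y1 + y2)) refl)
                                               (cong (_++ V3) (consecutive-++ 1 y1 y2 (suc y1) refl)))) ⟩
    (a1 + (a2 + a3)) ∷ map g ((V1 ++ V2) ++ V3)
      ≡⟨ cong (λ V → (a1 + (a2 + a3)) ∷ map g V) (++-assoc V1 V2 V3) ⟩
    (a1 + (a2 + a3)) ∷ map g (V1 ++ V2 ++ V3)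
      ≡⟨ cong ((a1 + (a2 + a3)) ∷_) (trans (map-++ g V1 (V2 ++ V3))
                                           (cong₂ _++_ g-leg1 (trans (map-++ g V2 V3) (cong₂ _++_ g-leg2 g-leg3)))) ⟩
    (a1 + (a2 + a3)) ∷ legVertexSums f1 ++ legVertexSums f2 ++ legVertexSums f3 ∎
    where
    open ≡-Reasoning
    V1 V2 V3 : List ℕ
    V1 = consecutive 1 y1
    V2 = consecutive (suc y1) y2
    V3 = consecutive (suc (y1 + y2)) y3

  spider-antimagic : Linked _≢_ ((a1 + (a2 + a3)) ∷ legVertexSums f1) →
                     Linked _≢_ ((a1 + (a2 + a3)) ∷ legVertexSums f2) →
                     Linked _≢_ ((a1 + (a2 + a3)) ∷ legVertexSums f3) →
                     All (λ e → g (proj₁ e) ≢ g (proj₂ e)) (edges G)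
  spider-antimagic linked1 linked2 linked3 =
    AllP.++⁺ (Linked⇒legEdges-distinct 0 (length L1) g (subst (Linked _≢_) (sym (cong₂ _∷_ g-core g-leg1)) linked1))
   (AllP.++⁺ (Linked⇒legEdges-distinct y1 (length L2) g (subst (Linked _≢_) (sym (cong₂ _∷_ g-core g-leg2)) linked2))
             (Linked⇒legEdges-distinct (y1 + y2) (length L3) g (subst (Linked _≢_) (sym (cong₂ _∷_ g-core g-leg3)) linked3)))

Unique-++⇒≢ : ∀ (xs ys : List ℕ) {a b} → Unique (xs ++ ys) → a ∈ xs → b ∈ ys → a ≢ b
Unique-++⇒≢ (x ∷ xs) ys (x∉xs++ys ∷ _) (here refl) b∈ys = All.lookup x∉xs++ys (∈-++⁺ʳ xs b∈ys)
Unique-++⇒≢ (x ∷ xs) ys (_ ∷ xs++ys!) (there a∈xs) b∈ys = Unique-++⇒≢ xs ys xs++ys! a∈xs b∈ys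

Unique-++⁻ʳ : ∀ (xs ys : List ℕ) → Unique (xs ++ ys) → Unique ys
Unique-++⁻ʳ [] ys ys! = ys!
Unique-++⁻ʳ (x ∷ xs) ys (_ ∷ xs++ys!) = Unique-++⁻ʳ xs ys xs++ys!

∈-delete : ∀ {y x : ℕ} (ys zs : List ℕ) → y ∈ ys ++ x ∷ zs → y ≢ x → y ∈ ys ++ zs
∈-delete [] zs (here y≡x) y≢x = ⊥-elim (y≢x y≡x)
∈-delete [] zs (there y∈zs) _ = y∈zs
∈-delete (_ ∷ ys) zs (here y≡z) _ = here y≡z
∈-delete (_ ∷ ys) zs (there y∈) y≢x = there (∈-delete ys zs y∈ y≢x)

Unique-⊆⇒length≤ : ∀ (xs ys : List ℕ) → Unique xs → All (_∈ ys) xs → length xs ≤ length ys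
Unique-⊆⇒length≤ [] ys _ _ = z≤n
Unique-⊆⇒length≤ (x ∷ xs) ys (x∉xs ∷ xs!) (x∈ys ∷ xs⊆ys) with ∈-∃++ x∈ys
... | ys₁ , ys₂ , refl =
  subst (suc (length xs) ≤_) (sym (length-++-sucʳ ys₁ x ys₂))
    (s≤s (Unique-⊆⇒length≤ xs (ys₁ ++ ys₂) xs!
      (All.zipWith (λ (y∈ , x≢y) → ∈-delete ys₁ ys₂ y∈ (≢-sym x≢y)) (xs⊆ys , x∉xs))))

length-deduplicate-≥4 : ∀ (S : List ℕ) a b c d → a ∈ S → b ∈ S → c ∈ S → d ∈ S →
  a ≢ b → a ≢ c → a ≢ d → b ≢ c → b ≢ d → c ≢ d → 4 ≤ length (deduplicate _≟_ S)
length-deduplicate-≥4 S a b c d a∈ b∈ c∈ d∈ a≢b a≢c a≢d b≢c b≢d c≢d =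
  Unique-⊆⇒length≤ (a ∷ b ∷ c ∷ d ∷ []) _
    ((a≢b ∷ a≢c ∷ a≢d ∷ []) ∷ (b≢c ∷ b≢d ∷ []) ∷ (c≢d ∷ []) ∷ [] ∷ [])
    (∈-deduplicate a∈ ∷ ∈-deduplicate b∈ ∷ ∈-deduplicate c∈ ∷ ∈-deduplicate d∈ ∷ [])
  where
  ∈-deduplicate : ∀ {x} → x ∈ S → x ∈ deduplicate _≟_ S
  ∈-deduplicate = AnyP.deduplicate⁺ _≟_ (λ y≡x x≡z → trans x≡z (sym y≡x))

length-deduplicate-≤4 : ∀ (S : List ℕ) a b c d → All (_∈ a ∷ b ∷ c ∷ d ∷ []) S →
  length (deduplicate _≟_ S) ≤ 4
length-deduplicate-≤4 S a b c d S⊆abcd =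
  Unique-⊆⇒length≤ _ (a ∷ b ∷ c ∷ d ∷ []) (deduplicate-! _≟_ S) (AllP.deduplicate⁺ _≟_ S⊆abcd)

record LegEnd (L : List ℕ) : Set where
  field
    previous last : ℕ
    previous∈ : previous ∈ L
    last∈ : last ∈ L
    last∈sums : last ∈ legVertexSums L
    previous+last∈sums : previous + last ∈ legVertexSums L

legEnd : ∀ a b L → LegEnd (a ∷ b ∷ L)
legEnd a b [] = record
  { previous = a ; last = b ; previous∈ = here refl ; last∈ = there (here refl)
  ; last∈sums = there (here refl) ; previous+last∈sums = here refl }
legEnd a b (c ∷ L) = record
  { previous = previous ; last = last ; previous∈ = there previous∈ ; last∈ = there last∈
  ; last∈sums = there last∈sums ; previous+last∈sums = there previous+last∈sums }
  where open LegEnd (legEnd b c L)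

exceeds-all : ∀ (P : ℕ → Set) l1 l2 l3 w1 w2 w3 → l1 < w1 → l2 < w2 → l3 < w3 → P w1 → P w2 → P w3 →
              Σ ℕ λ w → P w × l1 ≢ w × l2 ≢ w × l3 ≢ w
exceeds-all P l1 l2 l3 w1 w2 w3 l1<w1 l2<w2 l3<w3 p1 p2 p3 with l2 ≤? l1 | l3 ≤? l1 | l3 ≤? l2
... | yes l2≤l1 | yes l3≤l1 | _ =
  w1 , p1 , <⇒≢ l1<w1 , <⇒≢ (≤-<-trans l2≤l1 l1<w1) , <⇒≢ (≤-<-trans l3≤l1 l1<w1)
... | yes l2≤l1 | no l3≰l1 | _ =
  w3 , p3 , <⇒≢ (<-trans (≰⇒> l3≰l1) l3<w3) , <⇒≢ (≤-<-trans l2≤l1 (<-trans (≰⇒> l3≰l1) l3<w3)) , <⇒≢ l3<w3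
... | no l2≰l1 | _ | yes l3≤l2 =
  w2 , p2 , <⇒≢ (<-trans (≰⇒> l2≰l1) l2<w2) , <⇒≢ l2<w2 , <⇒≢ (≤-<-trans l3≤l2 l2<w2)
... | no l2≰l1 | _ | no l3≰l2 =
  w3 , p3 , <⇒≢ (<-trans (<-trans (≰⇒> l2≰l1) (≰⇒> l3≰l2)) l3<w3) , <⇒≢ (<-trans (≰⇒> l3≰l2) l3<w3) , <⇒≢ l3<w3

module _ (a1 b1 : ℕ) (L1 : List ℕ) (a2 b2 : ℕ) (L2 : List ℕ) (a3 b3 : ℕ) (L3 : List ℕ) where
  open SpiderLabeling a1 (b1 ∷ L1) a2 (b2 ∷ L2) a3 (b3 ∷ L3)

  private
    module E1 = LegEnd (legEnd a1 b1 L1)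
    module E2 = LegEnd (legEnd a2 b2 L2)
    module E3 = LegEnd (legEnd a3 b3 L3)
    S : List ℕ
    S = (a1 + (a2 + a3)) ∷ legVertexSums f1 ++ legVertexSums f2 ++ legVertexSums f3
    last<previous+last : ∀ {u l} → 1 ≤ u → l < u + l
    last<previous+last {u} {l} 1≤u = +-monoˡ-≤ l 1≤u
    ∈S₁ : ∀ {x} → x ∈ legVertexSums f1 → x ∈ S
    ∈S₁ x∈ = there (∈-++⁺ˡ x∈)
    ∈S₂ : ∀ {x} → x ∈ legVertexSums f2 → x ∈ S
    ∈S₂ x∈ = there (∈-++⁺ʳ (legVertexSums f1) (∈-++⁺ˡ x∈))
    ∈S₃ : ∀ {x} → x ∈ legVertexSums f3 → x ∈ S
    ∈S₃ x∈ = there (∈-++⁺ʳ (legVertexSums f1) (∈-++⁺ʳ (legVertexSums f2) x∈))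

  numColors-long-legs : Unique f → All (1 ≤_) f → 4 ≤ numColors G f
  numColors-long-legs f! f-pos
    with exceeds-all (_∈ S) E1.last E2.last E3.last
           (E1.previous + E1.last) (E2.previous + E2.last) (E3.previous + E3.last)
           (last<previous+last (All.lookup f-pos (∈-++⁺ˡ E1.previous∈)))
           (last<previous+last (All.lookup f-pos (∈-++⁺ʳ f1 (∈-++⁺ˡ E2.previous∈))))
           (last<previous+last (All.lookup f-pos (∈-++⁺ʳ f1 (∈-++⁺ʳ f2 E3.previous∈))))
           (∈S₁ E1.previous+last∈sums) (∈S₂ E2.previous+last∈sums) (∈S₃ E3.previous+last∈sums)
  ... | w , w∈S , l1≢w , l2≢w , l3≢w =
    subst (λ T → 4 ≤ length (deduplicate _≟_ T)) (sym vertexSums)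
      (length-deduplicate-≥4 S E1.last E2.last E3.last w
        (∈S₁ E1.last∈sums) (∈S₂ E2.last∈sums) (∈S₃ E3.last∈sums) w∈S
        (Unique-++⇒≢ f1 (f2 ++ f3) f! E1.last∈ (∈-++⁺ˡ E2.last∈))
        (Unique-++⇒≢ f1 (f2 ++ f3) f! E1.last∈ (∈-++⁺ʳ f2 E3.last∈))
        l1≢w
        (Unique-++⇒≢ f2 f3 (Unique-++⁻ʳ f1 (f2 ++ f3) f!) E2.last∈ E3.last∈)
        l2≢w l3≢w)

length-oneTo : ∀ q → length (oneTo q) ≡ q
length-oneTo q = trans (length-map suc (upTo q)) (length-applyUpTo id q)

length-edges-spider : ∀ y1 y2 y3 → length (edges (spider y1 y2 y3)) ≡ y1 + (y2 + y3)
length-edges-spider y1 y2 y3 =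
  trans (length-++ (legEdges 0 y1))
    (cong₂ _+_ (length-legEdges 0 y1)
               (trans (length-++ (legEdges y1 y2)) (cong₂ _+_ (length-legEdges y1 y2) (length-legEdges (y1 + y2) y3))))

↭-oneTo⇒Unique : ∀ {f q} → f ↭ oneTo q → Unique f
↭-oneTo⇒Unique f↭ = Unique-resp-↭ (↭⇒↭ₛ (↭-sym f↭)) (UP.map⁺ suc-injective (UP.upTo⁺ _))

↭-oneTo⇒positive : ∀ {f q} → f ↭ oneTo q → All (1 ≤_) f
↭-oneTo⇒positive f↭ = All-resp-↭ (↭-sym f↭) (AllP.map⁺ (All.universal (λ _ → s≤s z≤n) (upTo _)))

splitAtLength : ∀ a b (xs : List ℕ) → length xs ≡ a + b →
                Σ (List ℕ) λ ys → Σ (List ℕ) λ zs → xs ≡ ys ++ zs × length ys ≡ a × length zs ≡ b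
splitAtLength zero b xs ∣xs∣ = [] , xs , refl , refl , ∣xs∣
splitAtLength (suc a) b (x ∷ xs) ∣xs∣ with splitAtLength a b xs (suc-injective ∣xs∣)
... | ys , zs , refl , ∣ys∣ , ∣zs∣ = x ∷ ys , zs , refl , cong suc ∣ys∣ , ∣zs∣

numColors-spider≥4 : ∀ y1 y2 y3 f → IsBijLabeling (spider (suc (suc y1)) (suc (suc y2)) (suc (suc y3))) f →
                     4 ≤ numColors (spider (suc (suc y1)) (suc (suc y2)) (suc (suc y3))) f
numColors-spider≥4 y1 y2 y3 f f↭
  with splitAtLength (suc (suc y1)) (suc (suc y2) + suc (suc y3)) f
         (trans (↭-length f↭) (trans (length-oneTo _) (length-edges-spider (suc (suc y1)) (suc (suc y2)) (suc (suc y3)))))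
... | f1 , f23 , refl , ∣f1∣ , ∣f23∣ with splitAtLength (suc (suc y2)) (suc (suc y3)) f23 ∣f23∣
... | f2 , f3 , refl , ∣f2∣ , ∣f3∣ = long-legs f1 f2 f3 ∣f1∣ ∣f2∣ ∣f3∣ f↭
  where
  long-legs : ∀ f1 f2 f3 → length f1 ≡ suc (suc y1) → length f2 ≡ suc (suc y2) → length f3 ≡ suc (suc y3) →
              IsBijLabeling (spider (suc (suc y1)) (suc (suc y2)) (suc (suc y3))) (f1 ++ f2 ++ f3) →
              4 ≤ numColors (spider (suc (suc y1)) (suc (suc y2)) (suc (suc y3))) (f1 ++ f2 ++ f3)
  long-legs (a1 ∷ b1 ∷ L1) (a2 ∷ b2 ∷ L2) (a3 ∷ b3 ∷ L3) refl refl refl f↭ =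
    numColors-long-legs a1 b1 L1 a2 b2 L2 a3 b3 L3 (↭-oneTo⇒Unique f↭) (↭-oneTo⇒positive f↭)


-- zigzag a b k z = a, b+k-1, a+1, b+k-2, …, a+k-1, b, z.
zigzag : ℕ → ℕ → ℕ → ℕ → List ℕ
zigzag a b zero z = z ∷ []
zigzag a b (suc k) z = a ∷ (b + k) ∷ zigzag (suc a) b k z

alternating : ℕ → ℕ → ℕ → List ℕ
alternating zero s t = []
alternating (suc k) s t = s ∷ t ∷ alternating k s t

length-zigzag : ∀ a b k z → length (zigzag a b k z) ≡ suc (k + k)
length-zigzag a b zero z = refl
length-zigzag a b (suc k) z = cong (suc ∘ suc) (trans (length-zigzag (suc a) b k z) (sym (+-suc k k)))

legVertexSums-zigzag : ∀ k a b z {s c} → a + (b + k) ≡ s → b + z ≡ c →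
                       legVertexSums (zigzag a b (suc k) z) ≡ alternating k s (suc s) ++ s ∷ c ∷ z ∷ []
legVertexSums-zigzag zero a b z refl refl rewrite +-identityʳ b = refl
legVertexSums-zigzag (suc k) a b z refl refl =
  cong₂ _∷_ refl (cong₂ _∷_ (odd-sum≡s+1 a b k) (legVertexSums-zigzag k (suc a) b z (even-sum≡s a b k) refl))
  where
  odd-sum≡s+1 : ∀ a b k → b + suc k + suc a ≡ suc (a + (b + suc k))
  odd-sum≡s+1 = solve-∀
  even-sum≡s : ∀ a b k → suc a + (b + k) ≡ a + (b + suc k)
  even-sum≡s = solve-∀

zigzag-↭ : ∀ a b k z → zigzag a b k z ↭ consecutive a k ++ consecutive b k ++ [ z ]
zigzag-↭ a b zero z = ↭-refl
zigzag-↭ a b (suc k) z = begin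
  a ∷ (b + k) ∷ zigzag (suc a) b k z
    ↭⟨ prep a (prep (b + k) (zigzag-↭ (suc a) b k z)) ⟩
  a ∷ (b + k) ∷ consecutive (suc a) k ++ consecutive b k ++ [ z ]
    ↭⟨ prep a (↭-sym (shift (b + k) (consecutive (suc a) k) _)) ⟩
  a ∷ consecutive (suc a) k ++ (b + k) ∷ consecutive b k ++ [ z ]
    ↭⟨ prep a (++⁺ˡ (consecutive (suc a) k) (↭-sym (shift (b + k) (consecutive b k) [ z ]))) ⟩
  a ∷ consecutive (suc a) k ++ consecutive b k ++ [ b + k ] ++ [ z ]
    ≡⟨ cong (λ B → a ∷ consecutive (suc a) k ++ B)
            (trans (sym (++-assoc (consecutive b k) [ b + k ] [ z ])) (cong (_++ [ z ]) (sym (consecutive-∷ʳ b k)))) ⟩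
  a ∷ consecutive (suc a) k ++ consecutive b (suc k) ++ [ z ] ∎
  where open PermutationReasoning

Linked-alternating : ∀ k {x s c z} → x ≢ s → s ≢ c → c ≢ z →
                     Linked _≢_ (x ∷ alternating k s (suc s) ++ s ∷ c ∷ z ∷ [])
Linked-alternating zero x≢s s≢c c≢z = x≢s ∷ s≢c ∷ c≢z ∷ [-]
Linked-alternating (suc k) {s = s} x≢s s≢c c≢z =
  x≢s ∷ <⇒≢ (n<1+n s) ∷ Linked-alternating k (>⇒≢ (n<1+n s)) s≢c c≢z

All-alternating : ∀ {P : ℕ → Set} k {s t} → P s → P t → All P (alternating k s t)
All-alternating zero ps pt = []
All-alternating (suc k) ps pt = ps ∷ pt ∷ All-alternating k ps pt

module Construction (m′ n′ : ℕ) where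

  m n nm Q X : ℕ
  m = suc m′
  n = suc n′
  nm = n + m
  Q = 3 + nm + m + n
  X = suc (suc nm) + (suc n + (3 + nm + m))

  leg2-tail leg3-tail : List ℕ
  leg2-tail = zigzag (suc (suc n)) (3 + nm) m′ Q
  leg3-tail = zigzag (suc (3 + nm + m)) 1 n′ (suc Q)

  -- The legs are zigzag (nm+2) (nm+1) 1 (Q+2), zigzag (n+1) (nm+3) m Q and zigzag (nm+m+3) 1 n (Q+1),
  -- split into head and tail; all three have s = Q, and X is the core sum.
  open SpiderLabeling (suc (suc nm)) (suc nm + 0 ∷ [ suc (suc Q) ])
                      (suc n) (3 + nm + m′ ∷ leg2-tail)
                      (3 + nm + m) (1 + n′ ∷ leg3-tail) public

  private
    leg1-s≡Q : ∀ m′ n′ → suc (suc (suc n′ + suc m′)) + (suc (suc n′ + suc m′) + 0)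
                          ≡ 3 + (suc n′ + suc m′) + suc m′ + suc n′
    leg1-s≡Q = solve-∀
    leg1-b+z≡X : ∀ m′ n′ → suc (suc n′ + suc m′) + suc (suc (3 + (suc n′ + suc m′) + suc m′ + suc n′))
                          ≡ suc (suc (suc n′ + suc m′)) + (suc (suc n′) + (3 + (suc n′ + suc m′) + suc m′))
    leg1-b+z≡X = solve-∀
    leg2-s≡Q : ∀ m′ n′ → suc (suc n′) + (3 + (suc n′ + suc m′) + m′) ≡ 3 + (suc n′ + suc m′) + suc m′ + suc n′
    leg2-s≡Q = solve-∀
    leg2-b+z≡X : ∀ m′ n′ → 3 + (suc n′ + suc m′) + (3 + (suc n′ + suc m′) + suc m′ + suc n′)
                          ≡ suc (suc (suc n′ + suc m′)) + (suc (suc n′) + (3 + (suc n′ + suc m′) + suc m′))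
    leg2-b+z≡X = solve-∀
    leg3-s≡Q : ∀ m′ n′ → 3 + (suc n′ + suc m′) + suc m′ + (1 + n′) ≡ 3 + (suc n′ + suc m′) + suc m′ + suc n′
    leg3-s≡Q = solve-∀

  sums1 : legVertexSums f1 ≡ Q ∷ X ∷ suc (suc Q) ∷ []
  sums1 = legVertexSums-zigzag 0 (suc (suc nm)) (suc nm) (suc (suc Q)) (leg1-s≡Q m′ n′) (leg1-b+z≡X m′ n′)

  sums2 : legVertexSums f2 ≡ alternating m′ Q (suc Q) ++ Q ∷ X ∷ Q ∷ []
  sums2 = legVertexSums-zigzag m′ (suc n) (3 + nm) Q (leg2-s≡Q m′ n′) (leg2-b+z≡X m′ n′)

  sums3 : legVertexSums f3 ≡ alternating n′ Q (suc Q) ++ Q ∷ suc (suc Q) ∷ suc Q ∷ []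
  sums3 = legVertexSums-zigzag n′ (3 + nm + m) 1 (suc Q) (leg3-s≡Q m′ n′) refl

  Q+3≤X : 3 + Q ≤ X
  Q+3≤X = subst (3 + Q ≤_) (leg2-b+z≡X m′ n′) (+-monoˡ-≤ Q (m≤m+n 3 nm))

  X≢Q : X ≢ Q
  X≢Q = >⇒≢ (≤-trans (n≤1+n _) (≤-trans (n≤1+n _) Q+3≤X))

  X≢Q+2 : X ≢ suc (suc Q)
  X≢Q+2 = >⇒≢ Q+3≤X

  antimagic : All (λ e → g (proj₁ e) ≢ g (proj₂ e)) (edges G)
  antimagic = spider-antimagic
    (subst (λ S → Linked _≢_ (X ∷ S)) (sym sums1) (Linked-alternating 0 X≢Q (≢-sym X≢Q) X≢Q+2))
    (subst (λ S → Linked _≢_ (X ∷ S)) (sym sums2) (Linked-alternating m′ X≢Q (≢-sym X≢Q) X≢Q))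
    (subst (λ S → Linked _≢_ (X ∷ S)) (sym sums3)
           (Linked-alternating n′ X≢Q (<⇒≢ (m<n⇒m<1+n (n<1+n Q))) (>⇒≢ (n<1+n _))))

  y2≡ : y2 ≡ suc (m + m)
  y2≡ = length-zigzag (suc n) (3 + nm) m Q

  y3≡ : y3 ≡ suc (n + n)
  y3≡ = length-zigzag (3 + nm + m) 1 n (suc Q)

  private
    edge-count : ∀ m′ n′ → 3 + (suc (suc m′ + suc m′) + suc (suc n′ + suc n′))
                           ≡ suc n′ + (suc m′ + (1 + (1 + (suc m′ + (suc n′ + 3)))))
    edge-count = solve-∀
    nm+1+1 : ∀ m′ n′ → suc (suc n′ + suc m′) + 1 ≡ suc (suc (suc n′ + suc m′))
    nm+1+1 = solve-∀
    nm+2+1 : ∀ m′ n′ → suc (suc (suc n′ + suc m′)) + 1 ≡ 3 + (suc n′ + suc m′)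
    nm+2+1 = solve-∀

  oneTo-blocks : oneTo (length (edges G)) ≡
    consecutive 1 n ++ consecutive (suc n) m ++ [ suc nm ] ++ [ suc (suc nm) ] ++
    consecutive (3 + nm) m ++ consecutive (3 + nm + m) n ++ [ Q ] ++ [ suc Q ] ++ [ suc (suc Q) ]
  oneTo-blocks = begin
    oneTo (length (edges G))
      ≡⟨ cong oneTo (length-edges-spider y1 y2 y3) ⟩
    oneTo (3 + (y2 + y3))
      ≡⟨ oneTo-consecutive _ ⟩
    consecutive 1 (3 + (y2 + y3))
      ≡⟨ cong (consecutive 1) (trans (cong₂ (λ u v → 3 + (u + v)) y2≡ y3≡) (edge-count m′ n′)) ⟩
    consecutive 1 (n + (m + (1 + (1 + (m + (n + 3))))))
      ≡⟨ consecutive-++ 1 n _ (suc n) refl ⟩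
    consecutive 1 n ++ consecutive (suc n) (m + (1 + (1 + (m + (n + 3)))))
      ≡⟨ cong (consecutive 1 n ++_) (consecutive-++ (suc n) m _ (suc nm) refl) ⟩
    consecutive 1 n ++ consecutive (suc n) m ++ consecutive (suc nm) (1 + (1 + (m + (n + 3))))
      ≡⟨ cong (λ B → consecutive 1 n ++ consecutive (suc n) m ++ B)
              (consecutive-++ (suc nm) 1 _ (suc (suc nm)) (nm+1+1 m′ n′)) ⟩
    consecutive 1 n ++ consecutive (suc n) m ++ [ suc nm ] ++ consecutive (suc (suc nm)) (1 + (m + (n + 3)))
      ≡⟨ cong (λ B → consecutive 1 n ++ consecutive (suc n) m ++ [ suc nm ] ++ B)
              (consecutive-++ (suc (suc nm)) 1 _ (3 + nm) (nm+2+1 m′ n′)) ⟩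
    consecutive 1 n ++ consecutive (suc n) m ++ [ suc nm ] ++ [ suc (suc nm) ] ++ consecutive (3 + nm) (m + (n + 3))
      ≡⟨ cong (λ B → consecutive 1 n ++ consecutive (suc n) m ++ [ suc nm ] ++ [ suc (suc nm) ] ++ B)
              (trans (consecutive-++ (3 + nm) m _ (3 + nm + m) refl)
                     (cong (consecutive (3 + nm) m ++_) (consecutive-++ (3 + nm + m) n 3 Q refl))) ⟩
    consecutive 1 n ++ consecutive (suc n) m ++ [ suc nm ] ++ [ suc (suc nm) ] ++
    consecutive (3 + nm) m ++ consecutive (3 + nm + m) n ++ [ Q ] ++ [ suc Q ] ++ [ suc (suc Q) ] ∎
    where open ≡-Reasoning

  bijective : IsBijLabeling G f
  bijective = subst (f ↭_) (sym oneTo-blocks) (begin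
    f1 ++ f2 ++ f3
      ↭⟨ ++⁺ (zigzag-↭ (suc (suc nm)) (suc nm) 1 (suc (suc Q)))
             (++⁺ (zigzag-↭ (suc n) (3 + nm) m Q) (zigzag-↭ (3 + nm + m) 1 n (suc Q))) ⟩
    (consecutive (suc (suc nm)) 1 ++ consecutive (suc nm) 1 ++ [ suc (suc Q) ]) ++
    (consecutive (suc n) m ++ consecutive (3 + nm) m ++ [ Q ]) ++
    (consecutive (3 + nm + m) n ++ consecutive 1 n ++ [ suc Q ])
      ↭⟨ CM.solve 9 (λ A B C D E F q q+1 q+2 →
            (D ⊕ (C ⊕ q+2)) ⊕ ((B ⊕ (E ⊕ q)) ⊕ (F ⊕ (A ⊕ q+1)))
            ⊜ A ⊕ (B ⊕ (C ⊕ (D ⊕ (E ⊕ (F ⊕ (q ⊕ (q+1 ⊕ q+2))))))))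
          ↭-refl
          (consecutive 1 n) (consecutive (suc n) m) [ suc nm ] [ suc (suc nm) ]
          (consecutive (3 + nm) m) (consecutive (3 + nm + m) n) [ Q ] [ suc Q ] [ suc (suc Q) ] ⟩
    consecutive 1 n ++ consecutive (suc n) m ++ [ suc nm ] ++ [ suc (suc nm) ] ++
    consecutive (3 + nm) m ++ consecutive (3 + nm + m) n ++ [ Q ] ++ [ suc Q ] ++ [ suc (suc Q) ] ∎)
    where
    open PermutationReasoning
    module CM = Algebra.Solver.CommutativeMonoid (++-commutativeMonoid {A = ℕ})
    open CM using (_⊕_; _⊜_)

  colours-≤4 : numColors G f ≤ 4
  colours-≤4 = length-deduplicate-≤4 _ Q (suc Q) (suc (suc Q)) X
    (subst (All (_∈ Colours)) (sym vertexSums)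
      (subst (λ S → All (_∈ Colours) (X ∷ S)) (sym (cong₂ _++_ sums1 (cong₂ _++_ sums2 sums3)))
        (X∈ ∷ (Q∈ ∷ X∈ ∷ Q+2∈ ∷ [])
           ++ᴬ (All-alternating m′ Q∈ Q+1∈ ++ᴬ (Q∈ ∷ X∈ ∷ Q∈ ∷ []))
           ++ᴬ (All-alternating n′ Q∈ Q+1∈ ++ᴬ (Q∈ ∷ Q+2∈ ∷ Q+1∈ ∷ [])))))
    where
    infixr 5 _++ᴬ_
    _++ᴬ_ = AllP.++⁺
    Colours : List ℕ
    Colours = Q ∷ suc Q ∷ suc (suc Q) ∷ X ∷ []
    Q∈ : Q ∈ Colours
    Q∈ = here refl
    Q+1∈ : suc Q ∈ Colours
    Q+1∈ = there (here refl)
    Q+2∈ : suc (suc Q) ∈ Colours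
    Q+2∈ = there (there (here refl))
    X∈ : X ∈ Colours
    X∈ = there (there (there (here refl)))

  χ-la≡4 : ChiLaEq G 4
  χ-la≡4 = (f , (bijective , antimagic) , ≤-antisym colours-≤4 (numColors-spider≥4 1 (length leg2-tail) (length leg3-tail) f bijective))
         , λ f′ f′-antimagic → numColors-spider≥4 1 (length leg2-tail) (length leg3-tail) f′ (proj₁ f′-antimagic)

χ-la-spider-3-odd-odd : ∀ m′ n′ → ChiLaEq (spider 3 (suc (suc m′ + suc m′)) (suc (suc n′ + suc n′))) 4
χ-la-spider-3-odd-odd m′ n′ =
  subst (λ G → ChiLaEq G 4) (cong₂ (spider 3) y2≡ y3≡) χ-la≡4
  where open Construction m′ n′

theorem5p8 : (h m : ℕ) → 1 ≤ m →
    ChiLaEq (spider 3 (2 * m + 1) (2 * m + 2 * h + 1)) 4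
theorem5p8 h (suc m′) _ =
  subst (λ G → ChiLaEq G 4) (cong₂ (spider 3) (2m+1 m′) (2m+2h+1 m′ h)) (χ-la-spider-3-odd-odd m′ (m′ + h))
  where
  2m+1 : ∀ m′ → suc (suc m′ + suc m′) ≡ 2 * suc m′ + 1
  2m+1 = solve-∀
  2m+2h+1 : ∀ m′ h → suc (suc (m′ + h) + suc (m′ + h)) ≡ 2 * suc m′ + 2 * h + 1
  2m+2h+1 = solve-∀
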